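{- Let $T$ be a bipartite tournament and $M\subseteq V(T)$ such that $T$ is $M$-consistent, and let $(X_1,Y_1,X_2,Y_2,\dots)$ be the $M$-sequence of $T$. Then any feedback vertex set $S$ of $T$ with $S\cap M=\emptyset$ contains at least one endpoint of each long back edge.
   Context: A bipartite tournament is a directed graph whose vertex set is partitioned into two sets $A,B$ such that every pair $a\in A$, $b\in B$ is joined by exactly one arc and there are no arcs inside $A$ or inside $B$. A feedback vertex set is a set $S$ with $T-S$ acyclic. $N^+(v)$, $N^-(v)$ denote out- and in-neighbourhoods. For an acyclic bipartite tournament $D$, its canonical sequence $(V_1,V_2,\dots)$ is defined by: $V_i$ is the set of vertices with no incoming arcs in $D-\bigcup_{j<i}V_j$. $T$ is $M$-consistent if $T[M\cup\{v\}]$ is acyclic for every $v\in V(T)$. Two vertices $u,v$ are $M$-equivalent if $N^+(u)\cap M=N^+(v)\cap M$ and $N^-(u)\cap M=N^-(v)\cap M$. With $(Z_1,\dots,Z_l)$ the canonical sequence of $T[M]$: $v$ is $(M,Z_i)$-equivalent if $v$ is $M$-equivalent to some vertex of $Z_i$; $v$ is $(M,Z_i)$-conflicting if $N^+(v)\cap Z_i\neq\emptyset$, $N^-(v)\cap Z_i\neq\emptyset$, $N^+(v)\cap Z_j=\emptyset$ for all $j<i$ and $N^-(v)\cap Z_j=\emptyset$ for all $j>i$; $v$ is $M$-universal if it is not $(M,Z_i)$-equivalent for any $i$, $T[M\cup\{v\}]$ is acyclic, and some topological sort of $T[M\cup\{v\}]$ has $v$ first ($M^-$-universal) or last ($M^+$-universal).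 The $M$-sequence of $T$ is $(X_1,Y_1,\dots,X_l,Y_l)$ where $X_i$ is the set of all $(M,Z_i)$-equivalent vertices, $Y_i$ the set of all $(M,Z_i)$-conflicting vertices, and additionally $Y_1$ contains every $M^-$-universal vertex and $Y_l$ every $M^+$-universal vertex; $X_i\cup Y_i$ is the $i$-th block. An arc $u_iu_j\in E(T)$ (directed from $u_i$ to $u_j$) with $u_i\in X_i\cup Y_i$ and $u_j\in X_j\cup Y_j$ is a back edge if $i-j\ge 1$; it is a long back edge if $i-j\ge 2$. -}

module Defs where

open import Data.Nat using (ℕ; zero; suc; _<_; _+_; _≤_)
open import Data.Fin using (Fin)
open import Data.Fin.Subset using (Subset; _∈_)
open import Data.Bool using (Bool; true; false)
open import Data.Product using (_×_; ∃; ∃-syntax; _,_)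
open import Data.Sum using (_⊎_)
open import Data.List using (List; []; _∷_; _++_; [_])
open import Data.List.Relation.Unary.Unique.Propositional using (Unique)
import Data.List.Membership.Propositional as LM
open import Relation.Nullary using (¬_)
open import Data.Empty using (⊥)
open import Relation.Binary.PropositionalEquality using (_≡_; _≢_)
open import Function.Bundles using (_⇔_)

-- A bipartite tournament on the vertex set Fin n.
-- side v : which part (A = true, B = false) the vertex lies in;
-- E u v ≡ true  means there is an arc from u to v.
record BipTournament (n : ℕ) : Set where
  field
    side     : Fin n → Bool
    E        : Fin n → Fin n → Bool
    noInside : ∀ u v → E u v ≡ true → side u ≢ side v
    total    : ∀ u v → side u ≢ side v → (E u v ≡ true) ⊎ (E v u ≡ true)
    antisym  : ∀ u v → E u v ≡ true → E v u ≡ true → ⊥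

  Arc : Fin n → Fin n → Set
  Arc u v = E u v ≡ true

module _ {n : ℕ} (T : BipTournament n) where
  open BipTournament T

  VSet : Set₁
  VSet = Fin n → Set

  data Walk (P : VSet) : Fin n → Fin n → Set where
    edge : ∀ {u v} → P u → P v → Arc u v → Walk P u v
    step : ∀ {u w v} → P u → Arc u w → Walk P w v → Walk P u v

  Acyclic : VSet → Set
  Acyclic P = ∀ v → ¬ Walk P v v

  FVS : Subset n → Set
  FVS S = Acyclic (λ v → ¬ (v ∈ S))

  Src : VSet → VSet
  Src R v = R v × (∀ u → R u → ¬ Arc u v)

  -- canonical sequence of T[M] (0-indexed):
  -- Rem M i = M minus Z_0,...,Z_{i-1};  Z M i = sources of T[Rem M i]
  Rem : Subset n → ℕ → VSet
  Rem M zero    v = v ∈ M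
  Rem M (suc i) v = Rem M i v × ¬ Src (Rem M i) v

  Z : Subset n → ℕ → VSet
  Z M i = Src (Rem M i)

  IsLength : Subset n → ℕ → Set
  IsLength M l = (∀ v → ¬ Rem M l v) × (∀ i → i < l → ∃[ v ] Z M i v)

  Consistent : Subset n → Set
  Consistent M = ∀ v → Acyclic (λ x → x ∈ M ⊎ x ≡ v)

  MEquiv : Subset n → Fin n → Fin n → Set
  MEquiv M u v = ∀ w → w ∈ M → (Arc u w ⇔ Arc v w) × (Arc w u ⇔ Arc w v)

  EquivZ : Subset n → ℕ → Fin n → Set
  EquivZ M i v = ∃[ z ] (Z M i z × MEquiv M v z)

  ConflictZ : Subset n → ℕ → Fin n → Set
  ConflictZ M i v =
    (∃[ z ] (Z M i z × Arc v z)) ×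
    (∃[ z ] (Z M i z × Arc z v)) ×
    (∀ j → j < i → ∀ z → Z M j z → ¬ Arc v z) ×
    (∀ j → i < j → ∀ z → Z M j z → ¬ Arc z v)

  open LM using () renaming (_∈_ to _∈L_)

  TopSort : VSet → List (Fin n) → Set
  TopSort P L =
    Unique L ×
    (∀ x → (P x ⇔ x ∈L L)) ×
    (∀ x y → P x → P y → Arc x y →
       ∃[ L₁ ] ∃[ L₂ ] (L ≡ L₁ ++ x ∷ L₂ × y ∈L L₂))

  UnivBase : Subset n → Fin n → Set
  UnivBase M v = (∀ i → ¬ EquivZ M i v) × Acyclic (λ x → x ∈ M ⊎ x ≡ v)

  MinusUniv : Subset n → Fin n → Set
  MinusUniv M v = UnivBase M v ×
    ∃[ L ] TopSort (λ x → x ∈ M ⊎ x ≡ v) (v ∷ L)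

  PlusUniv : Subset n → Fin n → Set
  PlusUniv M v = UnivBase M v ×
    ∃[ L ] TopSort (λ x → x ∈ M ⊎ x ≡ v) (L ++ [ v ])

  -- M-sequence (0-indexed blocks 0..l-1): X_i, Y_i
  X : Subset n → ℕ → Fin n → Set
  X M i v = EquivZ M i v

  Y : Subset n → ℕ → ℕ → Fin n → Set
  Y M l i v = ConflictZ M i v ⊎ (i ≡ 0 × MinusUniv M v) ⊎ (suc i ≡ l × PlusUniv M v)

  InBlock : Subset n → ℕ → ℕ → Fin n → Set
  InBlock M l i v = i < l × (X M i v ⊎ Y M l i v)

  LongBackEdge : Subset n → ℕ → Fin n → Fin n → Set
  LongBackEdge M l u w =
    Arc u w × ∃[ i ] ∃[ j ] (InBlock M l i u × InBlock M l j w × 2 + j ≤ i)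

-- Let u → w be a long back edge, u in block i and w in block j ≤ i − 2.
-- Whatever kind of vertex w is (M-equivalent, conflicting or universal), it
-- has an out-neighbour m in some level Z_a with a ≤ j + 1; dually u has an
-- in-neighbour m′ in some level Z_b with b ≥ i − 1 ≥ j + 1.  Since the graph is
-- bipartite, m and m′ lie on opposite sides, so they are adjacent, and as m is
-- a source of T[Z_a ∪ Z_{a+1} ∪ …] ∋ m′ the arc goes m → m′.  Thus
-- u → w → m → m′ → u is a cycle whose only vertices outside M are u and w.
module Submission where

open import Defs
open import Data.Nat using (ℕ; zero; suc; _≤_; _<_; _≤′_; ≤′-refl; ≤′-step; s≤s)
open import Data.Nat.Properties using (≤-refl; ≤-trans; n≤1+n; <⇒≤; <-trans; <-irrefl; ≤⇒≤′)
open import Data.Fin.Subset using (Subset; _∈_)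
open import Data.Fin.Subset.Properties using (_∈?_)
open import Data.Sum using (_⊎_; inj₁; inj₂)
open import Data.Product using (_×_; _,_; proj₁; proj₂; ∃-syntax)
open import Data.Bool using (Bool)
import Data.Bool as Bool
open import Data.Bool.Properties using (¬-not)
open import Data.Empty using (⊥-elim)
open import Data.List using ([]; _∷_; _++_; [_])
open import Data.List.Properties using (∷-injectiveʳ)
open import Data.List.Relation.Unary.All using (lookup)
open import Data.List.Relation.Unary.AllPairs using (_∷_)
open import Data.List.Relation.Unary.Any using (here; there)
open import Data.List.Relation.Unary.Unique.Propositional using (Unique)
open import Data.List.Membership.Propositional using (_∉_)
open import Data.List.Membership.Propositional.Properties using (∈-++⁺ʳ)
open import Relation.Nullary using (¬_; yes; no)
open import Relation.Nullary.Decidable using (decidable-stable)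
open import Relation.Binary.PropositionalEquality using (_≡_; _≢_; refl; sym; trans)
open import Function.Base using (_∘_)
open import Function.Bundles using (Equivalence)

≢-≢⇒≡ : ∀ {a b c : Bool} → a ≢ c → b ≢ c → a ≡ b
≢-≢⇒≡ a≢c b≢c = trans (¬-not a≢c) (sym (¬-not b≢c))

module _ {A : Set} {v x : A} where

  head-∉-after : ∀ {L} L₁ {L₂} → Unique (v ∷ L) → v ∷ L ≡ L₁ ++ x ∷ L₂ → v ∉ L₂
  head-∉-after []       (v∉L ∷ _) refl v∈L₂ = lookup v∉L v∈L₂ refl
  head-∉-after (_ ∷ L₁) (v∉L ∷ _) refl v∈L₂ = lookup v∉L (∈-++⁺ʳ L₁ (there v∈L₂)) refl

  nothing-after-last : ∀ L L₁ {L₂} → Unique (L ++ [ v ]) → L ++ [ v ] ≡ L₁ ++ v ∷ L₂ → x ∉ L₂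
  nothing-after-last []      []           _         refl ()
  nothing-after-last []      (_ ∷ [])     _         ()
  nothing-after-last []      (_ ∷ _ ∷ _)  _         ()
  nothing-after-last (_ ∷ L) []           (v∉ ∷ _)  refl _ = lookup v∉ (∈-++⁺ʳ L (here refl)) refl
  nothing-after-last (_ ∷ L) (_ ∷ L₁)     (_ ∷ uq)  eq     = nothing-after-last L L₁ uq (∷-injectiveʳ eq)

module _ {n : ℕ} (T : BipTournament n) (M : Subset n) where
  open BipTournament T

  Rem⊆M : ∀ a {v} → Rem T M a v → v ∈ M
  Rem⊆M zero    v∈M        = v∈M
  Rem⊆M (suc a) (v∈Rem , _) = Rem⊆M a v∈Rem

  Z⊆M : ∀ {a v} → Z T M a v → v ∈ M
  Z⊆M {a} = Rem⊆M a ∘ proj₁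

  Rem-antitone′ : ∀ {a b v} → a ≤′ b → Rem T M b v → Rem T M a v
  Rem-antitone′ ≤′-refl      v∈Rem       = v∈Rem
  Rem-antitone′ (≤′-step a≤b) (v∈Rem , _) = Rem-antitone′ a≤b v∈Rem

  Rem-antitone : ∀ {a b v} → a ≤ b → Rem T M b v → Rem T M a v
  Rem-antitone = Rem-antitone′ ∘ ≤⇒≤′

  Z-nonempty : ∀ {l i} → IsLength T M l → i < l → ∃[ v ] Z T M i v
  Z-nonempty (_ , nonempty) = nonempty _

  earlier-level-arc : ∀ {a b m m′} → a ≤ b → Z T M a m → Z T M b m′ →
                      side m ≢ side m′ → Arc m m′
  earlier-level-arc {m = m} {m′} a≤b (_ , m-source) (m′∈Rem , _) m≢m′ with total m m′ m≢m′
  ... | inj₁ m→m′ = m→m′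
  ... | inj₂ m′→m = ⊥-elim (m-source m′ (Rem-antitone a≤b m′∈Rem) m′→m)

  Z-same-side : ∀ {a p q} → Z T M a p → Z T M a q → side p ≡ side q
  Z-same-side {p = p} {q} p∈Z q∈Z = decidable-stable (side p Bool.≟ side q) λ p≢q →
    proj₂ q∈Z p (proj₁ p∈Z) (earlier-level-arc ≤-refl p∈Z q∈Z p≢q)

  -- Only double-negated: finding p would need a search over Fin n with decidable Rem.
  Z-suc-in-neighbour : ∀ {k y} → Z T M (suc k) y → ¬ ¬ (∃[ p ] Z T M k p × Arc p y)
  Z-suc-in-neighbour ((y∈Rem , y-not-source) , y-source) no-neighbour =
    y-not-source (y∈Rem , λ p p∈Rem p→y →
      y-source p (p∈Rem , λ p∈Z → no-neighbour (p , p∈Z , p→y)) p→y)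

  Z-suc-dominated : ∀ {k z y} → Z T M k z → Z T M (suc k) y → Arc z y
  Z-suc-dominated {k} {z} {y} z∈Z y∈Z = earlier-level-arc (n≤1+n k) z∈Z y∈Z z≢y
    where
    z≢y : side z ≢ side y
    z≢y z≡y = Z-suc-in-neighbour y∈Z λ (p , p∈Z , p→y) →
      noInside p y p→y (trans (Z-same-side p∈Z z∈Z) z≡y)

  level-neighbour : ∀ {l k} → IsLength T M l → suc k < l → ∀ v →
                    ∃[ a ] k ≤ a × a ≤ suc k × ∃[ m ] Z T M a m × side v ≢ side m
  level-neighbour {k = k} isl sk<l v
    with Z-nonempty isl (<⇒≤ sk<l) | Z-nonempty isl sk<l
  ... | p , p∈Z | y , y∈Z with side v Bool.≟ side p
  ...   | no v≢p  = k , ≤-refl , n≤1+n k , p , p∈Z , v≢p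
  ...   | yes v≡p = suc k , n≤1+n k , ≤-refl , y , y∈Z , λ v≡y →
                      noInside p y (Z-suc-dominated p∈Z y∈Z) (trans (sym v≡p) v≡y)

  MinusUniv-out : ∀ {v x} → MinusUniv T M v → x ∈ M → side v ≢ side x → Arc v x
  MinusUniv-out {v} {x} (_ , _ , uniq , _ , ord) x∈M v≢x with total v x v≢x
  ... | inj₁ v→x = v→x
  ... | inj₂ x→v with ord x v (inj₁ x∈M) (inj₂ refl) x→v
  ...   | L₁ , _ , eq , v∈L₂ = ⊥-elim (head-∉-after L₁ uniq eq v∈L₂)

  PlusUniv-in : ∀ {v x} → PlusUniv T M v → x ∈ M → side v ≢ side x → Arc x v
  PlusUniv-in {v} {x} (_ , L , uniq , _ , ord) x∈M v≢x with total v x v≢x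
  ... | inj₂ x→v = x→v
  ... | inj₁ v→x with ord v x (inj₂ refl) (inj₁ x∈M) v→x
  ...   | L₁ , _ , eq , x∈L₂ = ⊥-elim (nothing-after-last L L₁ uniq eq x∈L₂)

  block-out-neighbour : ∀ {l j w} → IsLength T M l → suc j < l → InBlock T M l j w →
                        ∃[ a ] a ≤ suc j × ∃[ m ] Z T M a m × Arc w m
  block-out-neighbour {j = j} isl sj<l (_ , inj₁ (z , z∈Z , w≈z)) with Z-nonempty isl sj<l
  ... | y , y∈Z = suc j , ≤-refl , y , y∈Z ,
                  Equivalence.from (proj₁ (w≈z y (Z⊆M y∈Z))) (Z-suc-dominated z∈Z y∈Z)
  block-out-neighbour isl _ (_ , inj₂ (inj₁ ((z , z∈Z , w→z) , _))) =
    _ , n≤1+n _ , z , z∈Z , w→z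
  block-out-neighbour {w = w} isl sj<l (_ , inj₂ (inj₂ (inj₁ (refl , w-univ))))
    with level-neighbour isl sj<l w
  ... | a , _ , a≤1 , m , m∈Z , w≢m = a , a≤1 , m , m∈Z , MinusUniv-out w-univ (Z⊆M m∈Z) w≢m
  block-out-neighbour isl sj<l (_ , inj₂ (inj₂ (inj₂ (refl , _)))) = ⊥-elim (<-irrefl refl sj<l)

  block-in-neighbour : ∀ {l k u} → IsLength T M l → InBlock T M l (suc k) u →
                       ∃[ b ] k ≤ b × ∃[ m ] Z T M b m × Arc m u
  block-in-neighbour isl (sk<l , inj₁ (z , z∈Z , u≈z)) with Z-nonempty isl (<⇒≤ sk<l)
  ... | p , p∈Z = _ , ≤-refl , p , p∈Z ,
                  Equivalence.from (proj₂ (u≈z p (Z⊆M p∈Z))) (Z-suc-dominated p∈Z z∈Z)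
  block-in-neighbour isl (_ , inj₂ (inj₁ (_ , (z , z∈Z , z→u) , _))) =
    _ , n≤1+n _ , z , z∈Z , z→u
  block-in-neighbour isl (_ , inj₂ (inj₂ (inj₁ (() , _))))
  block-in-neighbour {u = u} isl (sk<l , inj₂ (inj₂ (inj₂ (refl , u-univ))))
    with level-neighbour isl sk<l u
  ... | b , k≤b , _ , m , m∈Z , u≢m = b , k≤b , m , m∈Z , PlusUniv-in u-univ (Z⊆M m∈Z) u≢m

  long-back-edge-closes-in-M : ∀ {l u w} → IsLength T M l → LongBackEdge T M l u w →
    ∃[ m ] ∃[ m′ ] m ∈ M × m′ ∈ M × Arc w m × Arc m m′ × Arc m′ u
  long-back-edge-closes-in-M {u = u} {w} isl (u→w , suc k , j , u∈B , w∈B , s≤s sj≤k)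
    with block-out-neighbour isl (<-trans (s≤s sj≤k) (proj₁ u∈B)) w∈B
       | block-in-neighbour isl u∈B
  ... | a , a≤sj , m , m∈Z , w→m | b , k≤b , m′ , m′∈Z , m′→u =
    m , m′ , Z⊆M m∈Z , Z⊆M m′∈Z , w→m ,
    earlier-level-arc (≤-trans a≤sj (≤-trans sj≤k k≤b)) m∈Z m′∈Z m≢m′ , m′→u
    where
    m≡u : side m ≡ side u
    m≡u = ≢-≢⇒≡ (λ e → noInside w m w→m (sym e)) (noInside u w u→w)
    m≢m′ : side m ≢ side m′
    m≢m′ e = noInside m′ u m′→u (trans (sym e) m≡u)

lemma29 : (n : ℕ) (T : BipTournament n) (M : Subset n) (l : ℕ) →
    Consistent T M → IsLength T M l →
    (S : Subset n) → FVS T S → (∀ v → v ∈ S → ¬ (v ∈ M)) →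
    ∀ u w → LongBackEdge T M l u w → u ∈ S ⊎ w ∈ S
lemma29 n T M l _ isl S acyclic S∩M=∅ u w back-edge@(u→w , _) with u ∈? S | w ∈? S
... | yes u∈S | _       = inj₁ u∈S
... | no _    | yes w∈S = inj₂ w∈S
... | no u∉S  | no w∉S  with long-back-edge-closes-in-M T M isl back-edge
...   | m , m′ , m∈M , m′∈M , w→m , m→m′ , m′→u =
  ⊥-elim (acyclic u (step u∉S u→w (step w∉S w→m (step (∉S m∈M) m→m′
    (edge (∉S m′∈M) u∉S m′→u)))))
  where
  ∉S : ∀ {x} → x ∈ M → ¬ (x ∈ S)
  ∉S x∈M x∈S = S∩M=∅ _ x∈S x∈M
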